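{- Let $k\ge 0$ and $n,m>0$ be integers. For every path $P\in T_{n,k,m}$, $$\mathrm{word}(\phi'_{n,k,m}(P))=\mathrm{flip}\circ\mathrm{rev}\circ\mathrm{sw}^{ - }_{1,-m}\circ\mathrm{rev}\circ\mathrm{flip}(\mathrm{word}(P)).$$
   Context: Words in $\{\mathrm{N},\mathrm{E}\}^*$ are identified with lattice paths from $(0,0)$ using unit north ($\mathrm{N}$) and east ($\mathrm{E}$) steps; $\mathrm{word}(P)$ is the word of a path $P$. $\mathrm{rev}$ reverses a word; $\mathrm{flip}$ interchanges the letters $\mathrm{N}$ and $\mathrm{E}$. For $r,s\in\mathbb{Z}$ and $w=w_1\cdots w_N$, define levels $l_0=0$, $l_i=l_{i-1}+r$ if $w_i=\mathrm{N}$ and $l_i=l_{i-1}+s$ if $w_i=\mathrm{E}$. The word $\mathrm{sw}^-_{r,s}(w)$ is obtained as follows: for $k=-1,-2,-3,\dots$ and then for $k=\dots,3,2,1,0$ (positive values decreasing, ending with $0$), scan $w$ from right to left and append each letter $w_i$ ($i\ge 1$) with $l_i=k$. $T_{n,k,m}$ is the set of lattice paths from $(0,0)$ to $(k+mn,n)$ with unit north and east steps that never go strictly to the right of the line $x=k+my$. For $P\in T_{n,k,m}$ its area vector is $g(P)=(g_0,\dots,g_{n-1})$, where $g_i$ is the number of complete unit lattice squares in the strip $\{x\ge0,\ i\le y\le i+1\}$ lying to the right of $P$ and to the left of the line $x=k+my$. The map $\phi'_{n,k,m}$: for each $i\ge 0$ let $z^{(i)}$ be the subsequence of $g(P)$ consisting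 of the entries lying in $\{i,i-1,\dots,i-m\}$, and let $M$ be the largest $i$ with $z^{(i)}$ nonempty. Let $\sigma^{(i)}\in\{\mathrm{N},\mathrm{E}\}^*$ be obtained from $z^{(i)}$ by replacing each entry equal to $i$ by $\mathrm{N}$ and every other entry by $\mathrm{E}$. For $k<i\le M$ the word $\sigma^{(i)}$ begins with $\mathrm{E}$; write $\sigma^{(i)}=\mathrm{E}\tilde\sigma^{(i)}$. Set $\tau^{(i)}=\mathrm{rev}(\sigma^{(i)})$ for $0\le i\le k$, $\tau^{(i)}=\mathrm{E}\,\mathrm{rev}(\tilde\sigma^{(i)})$ for $k<i\le M$, and $\tau^{(i)}$ empty for $i>M$. Then $\phi'_{n,k,m}(P)$ is the path with word $$\tau=\tau^{(0)}\,\mathrm{E}\tau^{(1)}\,\mathrm{E}\tau^{(2)}\cdots\mathrm{E}\tau^{(k)}\,\tau^{(k+1)}\cdots\tau^{(M)}$$ (an extra $\mathrm{E}$ is inserted before each of $\tau^{(1)},\dots,\tau^{(k)}$). -}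

module Defs where

open import Data.Nat as ℕ using (ℕ; zero; suc; _+_; _*_; _∸_; _≤_; _<_; _⊔_)
open import Data.Integer as ℤ using (ℤ; +_; -[1+_]; ∣_∣)
open import Data.List using (List; []; _∷_; _++_; reverse; map; filter; length; take; drop; concat; upTo; foldr; zip)
open import Data.Product using (_×_; _,_; proj₁; proj₂)
open import Data.Bool using (Bool; true; false; if_then_else_)
open import Relation.Nullary using (does; yes; no)
import Relation.Nullary
open import Relation.Binary.PropositionalEquality using (_≡_)

data Step : Set where
  N E : Step

Word : Set
Word = List Step

flipStep : Step → Step
flipStep N = E
flipStep E = N

flip : Word → Word
flip = map flipStep

rev : Word → Word
rev = reverse

countN : Word → ℕ
countN [] = 0
countN (N ∷ w) = suc (countN w)
countN (E ∷ w) = countN w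

countE : Word → ℕ
countE [] = 0
countE (N ∷ w) = countE w
countE (E ∷ w) = suc (countE w)

-- levels l_1 , ... , l_N  (l_0 = 0 is not attached to any letter)
levelsFrom : ℤ → ℤ → ℤ → Word → List ℤ
levelsFrom r s l [] = []
levelsFrom r s l (N ∷ w) = (l ℤ.+ r) ∷ levelsFrom r s (l ℤ.+ r) w
levelsFrom r s l (E ∷ w) = (l ℤ.+ s) ∷ levelsFrom r s (l ℤ.+ s) w

levels : ℤ → ℤ → Word → List ℤ
levels r s = levelsFrom r s (+ 0)

lettersAtLevel : ℤ → ℤ → Word → ℤ → Word
lettersAtLevel r s w k =
  map proj₁ (filter (λ p → proj₂ p ℤ.≟ k) (reverse (zip w (levels r s w))))

-- every level satisfies |l_i| ≤ B, where B = |w| * (|r| + |s|)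
levelBound : ℤ → ℤ → Word → ℕ
levelBound r s w = length w * (∣ r ∣ + ∣ s ∣)

levelOrder : ℕ → List ℤ
levelOrder B =
  map (λ j → -[1+ j ]) (upTo B)
  ++ reverse (map (λ j → + suc j) (upTo B))
  ++ (+ 0 ∷ [])

sw⁻ : ℤ → ℤ → Word → Word
sw⁻ r s w = concat (map (lettersAtLevel r s w) (levelOrder (levelBound r s w)))

-- T_{n,k,m}: paths (0,0) → (k+mn, n) never strictly right of x = k + m y.
-- A path stays weakly left of the line iff every lattice point it visits,
-- i.e. (countE u, countN u) for every prefix u, satisfies x ≤ k + m y.

record InT (n k m : ℕ) (w : Word) : Set where
  field
    endN   : countN w ≡ n
    endE   : countE w ≡ k + m * n
    weakly : ∀ j → countE (take j w) ≤ k + m * countN (take j w)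

-- In the strip i ≤ y ≤ i+1 the path is the vertical (i+1)-th N step, at
-- x = x_i (number of E steps before it); the line x = k + m y meets the
-- bottom of the strip at x = k + m i.  The complete unit squares
-- [j,j+1]×[i,i+1] right of P and left of the line are those with
-- x_i ≤ j and j + 1 ≤ k + m i, so g_i = k + m i − x_i
-- (x_i ≤ k + m i for paths in T_{n,k,m}, so ∸ is exact there).

areaAux : ℕ → ℕ → ℕ → ℕ → Word → List ℕ
areaAux k m x y [] = []
areaAux k m x y (N ∷ w) = (k + m * y ∸ x) ∷ areaAux k m x (suc y) w
areaAux k m x y (E ∷ w) = areaAux k m (suc x) y w

areaVector : ℕ → ℕ → Word → List ℕ
areaVector k m = areaAux k m 0 0

z : ℕ → List ℕ → ℕ → List ℕ
z m g i = filter (λ e → (e ℕ.≤? i) Relation.Nullary.×-dec (i ℕ.≤? e + m)) g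

σ : ℕ → List ℕ → ℕ → Word
σ m g i = map (λ e → if does (e ℕ.≟ i) then N else E) (z m g i)

-- M = largest i with z^(i) nonempty; an entry e lies in z^(i) exactly for
-- e ≤ i ≤ e + m, so M = max_j (g_j + m)  (g is nonempty since n > 0).
bigM : ℕ → List ℕ → ℕ
bigM m g = foldr _⊔_ 0 (map (_+ m) g)

-- τ^(i); for k < i ≤ M, σ^(i) = E σ̃^(i) and σ̃^(i) = drop 1 σ^(i).
τ : ℕ → ℕ → List ℕ → ℕ → Word
τ k m g i with i ℕ.≤? k
... | yes _ = rev (σ m g i)
... | no _ with i ℕ.≤? bigM m g
...   | yes _ = E ∷ rev (drop 1 (σ m g i))
...   | no _ = []

extraE : ℕ → ℕ → Word
extraE k zero = []
extraE k (suc i) with suc i ℕ.≤? k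
... | yes _ = E ∷ []
... | no _ = []

-- τ = τ^(0) E τ^(1) ... E τ^(k) τ^(k+1) ... τ^(M); the index range
-- 0 .. k + M covers everything (all further pieces are empty).
φ′ : ℕ → ℕ → ℕ → Word → Word
φ′ n k m w =
  let g = areaVector k m w in
  concat (map (λ i → extraE k i ++ τ k m g i) (upTo (suc (k + bigM m g))))

module Submission where

-- Measure every lattice point (x , y) of P by its horizontal
-- distance  d = k + m y - x  to the line x = k + m y.  An N step raises the
-- distance by m, an E step lowers it by 1; paths of T_{n,k,m} start at
-- distance k, never go below 0 and end at 0 ("admissible" paths), and the
-- area vector g(P) lists the distances at which the N steps start.
--
-- (1) Area side.  Let S_i be the word of steps of P starting at distance i
--     and [d < i] the word E if d < i, empty otherwise.  Induction along P
--     gives  [k < i] S_i = σ^(i) [0 < i]  (levelExchange); hence the i-th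
--     block of φ'(P), i.e. the extra E followed by τ^(i), is rev S_i (τ-block).
-- (2) Switch side.  In u = rev (flip P) the sw_{1,-m}-level of a letter is
--     exactly the distance at which the corresponding step of P starts
--     (rev-flip-levels), so flip (rev (sw⁻ u)) also lists, for i = 0, 1, ...,
--     the reversed steps at distance i (switch-side).
-- (3) Both sides are concatenations of the same blocks over initial index
--     ranges that differ only by empty blocks (concat-upTo-agree).
-- The argument works for all k, m, n; the hypotheses 0 < n, 0 < m are unused.

open import Defs
open import Data.Nat as ℕ using (ℕ; zero; suc; _+_; _*_; _∸_; _≤_; _<_; _⊔_; z≤n; s≤s)
import Data.Nat.Properties as ℕP
open import Data.List using (List; []; _∷_; _++_; reverse; map; filter; length; take; drop; concat; upTo; zip)
import Data.List.Properties as LP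
open import Data.Product using (_×_; _,_; proj₁; proj₂)
open import Data.Sum using (inj₁; inj₂)
import Data.Integer as ℤ
open import Data.Integer using (ℤ; +_; -_; -[1+_]; ∣_∣)
import Data.Integer.Properties as ℤP
open import Data.Bool using (true; false; if_then_else_)
open import Data.Empty using (⊥-elim)
open import Relation.Nullary using (does; yes; no; ¬_; _×-dec_)
open import Relation.Binary using (tri<; tri≈; tri>)
open import Relation.Nullary.Decidable using (dec-true; dec-false)
open import Relation.Binary.PropositionalEquality
  using (_≡_; _≢_; refl; sym; trans; cong; cong₂; subst; module ≡-Reasoning)

open ≡-Reasoning

flipStep-involutive : ∀ c → flipStep (flipStep c) ≡ c
flipStep-involutive N = refl
flipStep-involutive E = refl

countE≤length : ∀ w → countE w ≤ length w
countE≤length []      = z≤n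
countE≤length (N ∷ w) = ℕP.m≤n⇒m≤1+n (countE≤length w)
countE≤length (E ∷ w) = s≤s (countE≤length w)

concat-map-empty : ∀ {A : Set} {B : Set} (h : A → List B) xs →
                   (∀ x → h x ≡ []) → concat (map h xs) ≡ []
concat-map-empty h []       _     = refl
concat-map-empty h (x ∷ xs) empty =
  trans (cong (_++ concat (map h xs)) (empty x)) (concat-map-empty h xs empty)

-- flip ∘ rev of a concatenation is the concatenation of the flipped reversed
-- blocks in reverse order; this turns the right-to-left reading of sw⁻ into
-- a left-to-right one.
flip-reverse-concat : ∀ {A : Set} (f : A → Word) xs →
  flip (reverse (concat (map f xs))) ≡ concat (map (λ t → flip (reverse (f t))) (reverse xs))
flip-reverse-concat f []       = refl
flip-reverse-concat {A} f (t ∷ xs) = begin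
  flip (reverse (f t ++ concat (map f xs)))
    ≡⟨ cong flip (LP.reverse-++ (f t) (concat (map f xs))) ⟩
  flip (reverse (concat (map f xs)) ++ reverse (f t))
    ≡⟨ LP.map-++ flipStep (reverse (concat (map f xs))) (reverse (f t)) ⟩
  flip (reverse (concat (map f xs))) ++ h t
    ≡⟨ cong (_++ h t) (flip-reverse-concat f xs) ⟩
  concat (map h (reverse xs)) ++ h t
    ≡⟨ cong (concat (map h (reverse xs)) ++_) (sym (LP.++-identityʳ (h t))) ⟩
  concat (map h (reverse xs)) ++ concat (map h (t ∷ []))
    ≡⟨ LP.concat-++ (map h (reverse xs)) (map h (t ∷ [])) ⟩
  concat (map h (reverse xs) ++ map h (t ∷ []))
    ≡⟨ cong concat (sym (LP.map-++ h (reverse xs) (t ∷ []))) ⟩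
  concat (map h (reverse xs ++ t ∷ []))
    ≡⟨ cong (λ ys → concat (map h ys)) (sym (LP.unfold-reverse t xs)) ⟩
  concat (map h (reverse (t ∷ xs))) ∎
  where
    h : A → Word
    h t = flip (reverse (f t))

concat-upTo-shrink : ∀ {A : Set} (F : ℕ → List A) a b → a ≤ b → (∀ i → a ≤ i → F i ≡ []) →
                     concat (map F (upTo b)) ≡ concat (map F (upTo a))
concat-upTo-shrink F a zero    z≤n _     = refl
concat-upTo-shrink F a (suc b) a≤b empty with ℕP.m≤n⇒m<n∨m≡n a≤b
... | inj₂ refl        = refl
... | inj₁ (s≤s a≤b′) = begin
  concat (map F (upTo (suc b)))
    ≡⟨ cong (λ is → concat (map F is)) (sym (LP.upTo-∷ʳ b)) ⟩
  concat (map F (upTo b ++ b ∷ []))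
    ≡⟨ cong concat (LP.map-++ F (upTo b) (b ∷ [])) ⟩
  concat (map F (upTo b) ++ F b ∷ [])
    ≡⟨ sym (LP.concat-++ (map F (upTo b)) (F b ∷ [])) ⟩
  concat (map F (upTo b)) ++ (F b ++ [])
    ≡⟨ cong (λ x → concat (map F (upTo b)) ++ (x ++ [])) (empty b a≤b′) ⟩
  concat (map F (upTo b)) ++ []
    ≡⟨ LP.++-identityʳ _ ⟩
  concat (map F (upTo b))
    ≡⟨ concat-upTo-shrink F a b a≤b′ empty ⟩
  concat (map F (upTo a)) ∎

concat-upTo-agree : ∀ {A : Set} {F G : ℕ → List A} {a b} → (∀ i → F i ≡ G i) →
                    (∀ i → a ≤ i → F i ≡ []) → (∀ i → b ≤ i → G i ≡ []) →
                    concat (map F (upTo a)) ≡ concat (map G (upTo b))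
concat-upTo-agree {F = F} {G} {a} {b} F≗G F-empty G-empty = begin
  concat (map F (upTo a))       ≡⟨ sym (concat-upTo-shrink F a (a ⊔ b) (ℕP.m≤m⊔n a b) F-empty) ⟩
  concat (map F (upTo (a ⊔ b))) ≡⟨ cong concat (LP.map-cong F≗G (upTo (a ⊔ b))) ⟩
  concat (map G (upTo (a ⊔ b))) ≡⟨ concat-upTo-shrink G b (a ⊔ b) (ℕP.m≤n⊔m a b) G-empty ⟩
  concat (map G (upTo b))       ∎

rotation-reverse : ∀ {A : Set} (a : A) xs S → a ∷ S ≡ xs ++ a ∷ [] → xs ≢ [] →
                   a ∷ reverse (drop 1 xs) ≡ reverse S
rotation-reverse a []       S _  nonempty = ⊥-elim (nonempty refl)
rotation-reverse a (x ∷ xs) S eq _        = begin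
  a ∷ reverse xs          ≡⟨ sym (LP.reverse-++ xs (a ∷ [])) ⟩
  reverse (xs ++ a ∷ [])  ≡⟨ cong reverse (sym (LP.∷-injectiveʳ eq)) ⟩
  reverse S               ∎

module Distance (m : ℕ) where

  -- Each step labelled by the distance to the line at its starting point.
  labelled : ℕ → Word → List (Step × ℕ)
  labelled d []      = []
  labelled d (N ∷ w) = (N , d) ∷ labelled (d + m) w
  labelled d (E ∷ w) = (E , d) ∷ labelled (d ∸ 1) w

  areaFrom : ℕ → Word → List ℕ
  areaFrom d []      = []
  areaFrom d (N ∷ w) = d ∷ areaFrom (d + m) w
  areaFrom d (E ∷ w) = areaFrom (d ∸ 1) w

  data Admissible : ℕ → Word → Set where
    end  : Admissible 0 []
    up   : ∀ {d w} → Admissible (d + m) w → Admissible d (N ∷ w)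
    left : ∀ {d w} → Admissible d w → Admissible (suc d) (E ∷ w)

  stepsAt : ℕ → List (Step × ℕ) → Word
  stepsAt i []             = []
  stepsAt i ((c , a) ∷ ps) = if does (a ℕ.≟ i) then c ∷ stepsAt i ps else stepsAt i ps

  stepsAt-self : ∀ i c ps → stepsAt i ((c , i) ∷ ps) ≡ c ∷ stepsAt i ps
  stepsAt-self i c ps rewrite dec-true (i ℕ.≟ i) refl = refl

  stepsAt-other : ∀ {i a} c ps → a ≢ i → stepsAt i ((c , a) ∷ ps) ≡ stepsAt i ps
  stepsAt-other {i} {a} c ps a≢i rewrite dec-false (a ℕ.≟ i) a≢i = refl

  -- Distances never exceed d + m·(number of N steps), so high levels are empty.
  stepsAt-vanish : ∀ {d w} → Admissible d w → ∀ i → d + m * countN w < i → stepsAt i (labelled d w) ≡ []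
  stepsAt-vanish end i _ = refl
  stepsAt-vanish {d} {N ∷ w} (up adm) i bound =
    trans (stepsAt-other N (labelled (d + m) w) (ℕP.<⇒≢ (ℕP.≤-<-trans (ℕP.m≤m+n d _) bound)))
          (stepsAt-vanish adm i (subst (_< i) regroup bound))
    where
      regroup : d + m * suc (countN w) ≡ d + m + m * countN w
      regroup = trans (cong (_+_ d) (ℕP.*-suc m (countN w))) (sym (ℕP.+-assoc d m (m * countN w)))
  stepsAt-vanish {suc d} {E ∷ w} (left adm) i bound =
    trans (stepsAt-other E (labelled d w) (ℕP.<⇒≢ (ℕP.≤-<-trans (ℕP.m≤m+n (suc d) _) bound)))
          (stepsAt-vanish adm i (ℕP.<-trans (ℕP.n<1+n _) bound))

  σ-++ : ∀ g h i → σ m (g ++ h) i ≡ σ m g i ++ σ m h i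
  σ-++ g h i = trans (cong (map _) (LP.filter-++ (λ e → (e ℕ.≤? i) ×-dec (i ℕ.≤? e + m)) g h))
                     (LP.map-++ _ (z m g i) (z m h i))

  σ-single-self : ∀ i → σ m (i ∷ []) i ≡ N ∷ []
  σ-single-self i
    rewrite dec-true ((i ℕ.≤? i) ×-dec (i ℕ.≤? i + m)) (ℕP.≤-refl , ℕP.m≤m+n i m)
          | dec-true (i ℕ.≟ i) refl = refl

  σ-single-below : ∀ {d i} → d < i → i ≤ d + m → σ m (d ∷ []) i ≡ E ∷ []
  σ-single-below {d} {i} d<i i≤d+m
    rewrite dec-true ((d ℕ.≤? i) ×-dec (i ℕ.≤? d + m)) (ℕP.<⇒≤ d<i , i≤d+m)
          | dec-false (d ℕ.≟ i) (ℕP.<⇒≢ d<i) = refl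

  σ-single-outside : ∀ {d i} → ¬ (d ≤ i × i ≤ d + m) → σ m (d ∷ []) i ≡ []
  σ-single-outside {d} {i} outside
    rewrite dec-false ((d ℕ.≤? i) ×-dec (i ℕ.≤? d + m)) outside = refl

  σ-empty : ∀ i g → bigM m g < i → σ m g i ≡ []
  σ-empty i []      _     = refl
  σ-empty i (e ∷ g) M<i = trans (σ-++ (e ∷ []) g i)
    (cong₂ _++_ (σ-single-outside (λ (_ , i≤e+m) → ℕP.<⇒≱ (ℕP.m⊔n<o⇒m<o (e + m) (bigM m g) M<i) i≤e+m))
                (σ-empty i g (ℕP.m⊔n<o⇒n<o (e + m) (bigM m g) M<i)))

  -- ... while for an admissible path from distance d, every σ^(i) with
  -- d < i ≤ M is nonempty (the area entries rise by at most m at a time).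
  σ-nonempty : ∀ i d w → d < i → i ≤ bigM m (areaFrom d w) → σ m (areaFrom d w) i ≢ []
  σ-nonempty i d []      d<i i≤M _ = ℕP.n≮0 (ℕP.<-≤-trans d<i i≤M)
  σ-nonempty i d (N ∷ w) d<i i≤M empty with i ℕ.≤? d + m
  ... | yes i≤d+m with () ← trans (cong (_++ σ m (areaFrom (d + m) w) i) (sym (σ-single-below d<i i≤d+m)))
                                  (trans (sym (σ-++ (d ∷ []) (areaFrom (d + m) w) i)) empty)
  ... | no i≰d+m = σ-nonempty i (d + m) w (ℕP.≰⇒> i≰d+m) i≤M′
                     (trans (sym (cong (_++ σ m (areaFrom (d + m) w) i) (σ-single-outside (λ (_ , p) → i≰d+m p))))
                            (trans (sym (σ-++ (d ∷ []) (areaFrom (d + m) w) i)) empty))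
    where
      i≤M′ : i ≤ bigM m (areaFrom (d + m) w)
      i≤M′ with ℕP.≤-total (d + m) (bigM m (areaFrom (d + m) w))
      ... | inj₁ d+m≤M = subst (i ≤_) (ℕP.m≤n⇒m⊔n≡n d+m≤M) i≤M
      ... | inj₂ M≤d+m = ⊥-elim (i≰d+m (subst (i ≤_) (ℕP.m≥n⇒m⊔n≡m M≤d+m) i≤M))
  σ-nonempty i d (E ∷ w) d<i i≤M empty =
    σ-nonempty i (d ∸ 1) w (ℕP.≤-<-trans (ℕP.m∸n≤m d 1) d<i) i≤M empty

  lowE : ℕ → ℕ → Word
  lowE i d = if does (d ℕ.<? i) then E ∷ [] else []

  lowE-below : ∀ {i d} → d < i → lowE i d ≡ E ∷ []
  lowE-below {i} {d} d<i rewrite dec-true (d ℕ.<? i) d<i = refl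

  lowE-above : ∀ {i d} → i ≤ d → lowE i d ≡ []
  lowE-above {i} {d} i≤d rewrite dec-false (d ℕ.<? i) (ℕP.≤⇒≯ i≤d) = refl

  exchange-N : ∀ i d ps → lowE i d ++ stepsAt i ((N , d) ∷ ps) ≡ σ m (d ∷ []) i ++ (lowE i (d + m) ++ stepsAt i ps)
  exchange-N i d ps with ℕP.<-cmp d i
  ... | tri≈ _ refl _
    rewrite lowE-above {d} {d} ℕP.≤-refl | stepsAt-self d N ps | σ-single-self d
          | lowE-above {d} {d + m} (ℕP.m≤m+n d m) = refl
  ... | tri> _ d≢i i<d
    rewrite lowE-above (ℕP.<⇒≤ i<d) | stepsAt-other N ps d≢i
          | σ-single-outside (λ (d≤i , _) → ℕP.<⇒≱ i<d d≤i)
          | lowE-above (ℕP.≤-trans (ℕP.<⇒≤ i<d) (ℕP.m≤m+n d m)) = refl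
  ... | tri< d<i d≢i _ with i ℕ.≤? d + m
  ...   | yes i≤d+m
    rewrite lowE-below d<i | stepsAt-other N ps d≢i | σ-single-below d<i i≤d+m
          | lowE-above i≤d+m = refl
  ...   | no i≰d+m
    rewrite lowE-below d<i | stepsAt-other N ps d≢i
          | σ-single-outside (λ (_ , i≤d+m) → i≰d+m i≤d+m)
          | lowE-below (ℕP.≰⇒> i≰d+m) = refl

  exchange-E : ∀ i d ps → lowE i (suc d) ++ stepsAt i ((E , suc d) ∷ ps) ≡ lowE i d ++ stepsAt i ps
  exchange-E i d ps with ℕP.<-cmp (suc d) i
  ... | tri≈ _ refl _
    rewrite lowE-above {suc d} {suc d} ℕP.≤-refl | stepsAt-self (suc d) E ps
          | lowE-below {suc d} {d} (ℕP.n<1+n d) = refl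
  ... | tri< sd<i sd≢i _
    rewrite lowE-below sd<i | stepsAt-other E ps sd≢i
          | lowE-below (ℕP.<-trans (ℕP.n<1+n d) sd<i) = refl
  ... | tri> _ sd≢i i<sd
    rewrite lowE-above (ℕP.<⇒≤ i<sd) | stepsAt-other E ps sd≢i
          | lowE-above (ℕP.≤-pred i<sd) = refl

  levelExchange : ∀ i {d w} → Admissible d w →
                  lowE i d ++ stepsAt i (labelled d w) ≡ σ m (areaFrom d w) i ++ lowE i 0
  levelExchange i end = LP.++-identityʳ (lowE i 0)
  levelExchange i {d} {N ∷ w} (up adm) = begin
    lowE i d ++ stepsAt i ((N , d) ∷ ps)             ≡⟨ exchange-N i d ps ⟩
    σ m (d ∷ []) i ++ (lowE i (d + m) ++ stepsAt i ps) ≡⟨ cong (σ m (d ∷ []) i ++_) (levelExchange i adm) ⟩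
    σ m (d ∷ []) i ++ (σ m g i ++ lowE i 0)         ≡⟨ sym (LP.++-assoc (σ m (d ∷ []) i) (σ m g i) (lowE i 0)) ⟩
    (σ m (d ∷ []) i ++ σ m g i) ++ lowE i 0         ≡⟨ cong (_++ lowE i 0) (sym (σ-++ (d ∷ []) g i)) ⟩
    σ m (d ∷ g) i ++ lowE i 0                       ∎
    where
      ps : List (Step × ℕ)
      ps = labelled (d + m) w
      g : List ℕ
      g  = areaFrom (d + m) w
  levelExchange i {suc d} {E ∷ w} (left adm) = trans (exchange-E i d (labelled d w)) (levelExchange i adm)

  exchange-inside : ∀ {k w i} → Admissible k w → i ≤ k →
                    stepsAt i (labelled k w) ≡ σ m (areaFrom k w) i ++ lowE i 0
  exchange-inside {k} {w} {i} adm i≤k =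
    trans (cong (_++ stepsAt i (labelled k w)) (sym (lowE-above i≤k))) (levelExchange i adm)

  exchange-outside : ∀ {k w i} → Admissible k w → k < i →
                     E ∷ stepsAt i (labelled k w) ≡ σ m (areaFrom k w) i ++ E ∷ []
  exchange-outside {k} {w} {i} adm k<i = begin
    E ∷ stepsAt i (labelled k w)                ≡⟨ cong (_++ stepsAt i (labelled k w)) (sym (lowE-below k<i)) ⟩
    lowE i k ++ stepsAt i (labelled k w)        ≡⟨ levelExchange i adm ⟩
    σ m (areaFrom k w) i ++ lowE i 0            ≡⟨ cong (σ m (areaFrom k w) i ++_) (lowE-below (ℕP.≤-<-trans z≤n k<i)) ⟩
    σ m (areaFrom k w) i ++ E ∷ []              ∎

  τ-block : ∀ {k w} → Admissible k w → ∀ i →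
            extraE k i ++ τ k m (areaFrom k w) i ≡ reverse (stepsAt i (labelled k w))
  τ-block {k} adm zero with zero ℕ.≤? k
  ... | no 0≰k = ⊥-elim (0≰k z≤n)
  ... | yes 0≤k = cong reverse (sym (trans (exchange-inside adm 0≤k) (LP.++-identityʳ _)))
  τ-block {k} {w} adm (suc i) with suc i ℕ.≤? k
  ... | yes i<k = begin
    E ∷ reverse σ′          ≡⟨ sym (LP.reverse-++ σ′ (E ∷ [])) ⟩
    reverse (σ′ ++ E ∷ [])  ≡⟨ cong (λ x → reverse (σ′ ++ x)) (sym (lowE-below {suc i} {0} (s≤s z≤n))) ⟩
    reverse (σ′ ++ lowE (suc i) 0) ≡⟨ cong reverse (sym (exchange-inside adm i<k)) ⟩
    reverse (stepsAt (suc i) (labelled k w)) ∎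
    where σ′ = σ m (areaFrom k w) (suc i)
  ... | no i≮k with suc i ℕ.≤? bigM m (areaFrom k w)
  ...   | yes i≤M = rotation-reverse E σ′ (stepsAt (suc i) (labelled k w))
                      (exchange-outside adm (ℕP.≰⇒> i≮k)) (σ-nonempty (suc i) k w (ℕP.≰⇒> i≮k) i≤M)
    where σ′ = σ m (areaFrom k w) (suc i)
  ...   | no i≰M = cong reverse (sym (LP.∷-injectiveʳ
                     (trans (exchange-outside adm (ℕP.≰⇒> i≮k))
                            (cong (_++ E ∷ []) (σ-empty (suc i) (areaFrom k w) (ℕP.≰⇒> i≰M))))))

  block-vanish : ∀ k g i → suc (k + bigM m g) ≤ i → extraE k i ++ τ k m g i ≡ []
  block-vanish k g (suc i) bound with suc i ℕ.≤? k
  ... | yes i<k = ⊥-elim (ℕP.<⇒≱ (ℕP.<-≤-trans (s≤s (ℕP.m≤m+n k (bigM m g))) bound) i<k)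
  ... | no _ with suc i ℕ.≤? bigM m g
  ...   | yes i≤M = ⊥-elim (ℕP.<⇒≱ (ℕP.<-≤-trans (s≤s (ℕP.m≤n+m (bigM m g) k)) bound) i≤M)
  ...   | no _ = refl

  rise fall : ℤ
  rise = + 1
  fall = - (+ m)

  increment : Step → ℤ
  increment N = rise
  increment E = fall

  zipLevels : ℤ → Word → List (Step × ℤ)
  zipLevels l u = zip u (levelsFrom rise fall l u)

  endLevel : ℤ → Word → ℤ
  endLevel l []      = l
  endLevel l (c ∷ u) = endLevel (l ℤ.+ increment c) u

  zipLevels-snoc : ∀ l u c → zipLevels l (u ++ c ∷ []) ≡ zipLevels l u ++ (c , endLevel l u ℤ.+ increment c) ∷ []
  zipLevels-snoc l []      N = refl
  zipLevels-snoc l []      E = refl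
  zipLevels-snoc l (N ∷ u) c = cong ((N , l ℤ.+ rise) ∷_) (zipLevels-snoc (l ℤ.+ rise) u c)
  zipLevels-snoc l (E ∷ u) c = cong ((E , l ℤ.+ fall) ∷_) (zipLevels-snoc (l ℤ.+ fall) u c)

  endLevel-snoc : ∀ l u c → endLevel l (u ++ c ∷ []) ≡ endLevel l u ℤ.+ increment c
  endLevel-snoc l []      c = refl
  endLevel-snoc l (c′ ∷ u) c = endLevel-snoc (l ℤ.+ increment c′) u c

  Levelled : Word → List (Step × ℤ) → ℤ → Set
  Levelled u ps l = reverse (zipLevels (+ 0) u) ≡ ps × endLevel (+ 0) u ≡ l

  levelled-snoc : ∀ u c {ps e d} → Levelled u ps (+ e) → + e ℤ.+ increment c ≡ + d →
                  Levelled (u ++ c ∷ []) ((c , + d) ∷ ps) (+ d)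
  levelled-snoc u c {ps} {d = d} (rev-zip , ends) step = rev-zip′ , ends′
    where
      last≡d : endLevel (+ 0) u ℤ.+ increment c ≡ + d
      last≡d = trans (cong (ℤ._+ increment c) ends) step
      ends′ : endLevel (+ 0) (u ++ c ∷ []) ≡ + d
      ends′ = trans (endLevel-snoc (+ 0) u c) last≡d
      rev-zip′ : reverse (zipLevels (+ 0) (u ++ c ∷ [])) ≡ (c , + d) ∷ ps
      rev-zip′ = begin
        reverse (zipLevels (+ 0) (u ++ c ∷ []))
          ≡⟨ cong reverse (zipLevels-snoc (+ 0) u c) ⟩
        reverse (zipLevels (+ 0) u ++ (c , endLevel (+ 0) u ℤ.+ increment c) ∷ [])
          ≡⟨ LP.reverse-++ (zipLevels (+ 0) u) _ ⟩
        (c , endLevel (+ 0) u ℤ.+ increment c) ∷ reverse (zipLevels (+ 0) u)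
          ≡⟨ cong₂ (λ l qs → (c , l) ∷ qs) last≡d rev-zip ⟩
        (c , + d) ∷ ps ∎

  flipLabel : Step × ℕ → Step × ℤ
  flipLabel (c , a) = (flipStep c , + a)

  rev-flip-levels : ∀ {d w} → Admissible d w → Levelled (rev (flip w)) (map flipLabel (labelled d w)) (+ d)
  rev-flip-levels end = refl , refl
  rev-flip-levels {d} {N ∷ w} (up adm) =
    subst (λ u → Levelled u (map flipLabel (labelled d (N ∷ w))) (+ d)) (sym (LP.unfold-reverse E (flip w)))
          (levelled-snoc (rev (flip w)) E (rev-flip-levels adm) fall-after-N)
    where
      fall-after-N : + (d + m) ℤ.+ fall ≡ + d
      fall-after-N = begin
        (+ d ℤ.+ + m) ℤ.+ - (+ m) ≡⟨ ℤP.+-assoc (+ d) (+ m) (- (+ m)) ⟩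
        + d ℤ.+ (+ m ℤ.+ - (+ m)) ≡⟨ cong (ℤ._+_ (+ d)) (ℤP.+-inverseʳ (+ m)) ⟩
        + d ℤ.+ + 0               ≡⟨ ℤP.+-identityʳ (+ d) ⟩
        + d                       ∎
  rev-flip-levels {suc d} {E ∷ w} (left adm) =
    subst (λ u → Levelled u (map flipLabel (labelled (suc d) (E ∷ w))) (+ suc d)) (sym (LP.unfold-reverse N (flip w)))
          (levelled-snoc (rev (flip w)) N (rev-flip-levels adm) (cong +_ (ℕP.+-comm d 1)))

  select-level : ∀ ps i → flip (map proj₁ (filter (λ p → proj₂ p ℤ.≟ + i) (map flipLabel ps))) ≡ stepsAt i ps
  select-level []             i = refl
  select-level ((c , a) ∷ ps) i with a ℕ.≡ᵇ i
  ... | true  = cong₂ _∷_ (flipStep-involutive c) (select-level ps i)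
  ... | false = select-level ps i

  select-negative : ∀ ps j → map proj₁ (filter (λ p → proj₂ p ℤ.≟ -[1+ j ]) (map flipLabel ps)) ≡ []
  select-negative []       j = refl
  select-negative (_ ∷ ps) j = select-negative ps j

  levelOrder-reverse : ∀ B → reverse (levelOrder B) ≡ map +_ (upTo (suc B)) ++ reverse (map (λ j → -[1+ j ]) (upTo B))
  levelOrder-reverse B = begin
    reverse (negs ++ (poss ++ + 0 ∷ []))          ≡⟨ LP.reverse-++ negs (poss ++ + 0 ∷ []) ⟩
    reverse (poss ++ + 0 ∷ []) ++ reverse negs   ≡⟨ cong (_++ reverse negs) (LP.reverse-++ poss (+ 0 ∷ [])) ⟩
    (+ 0 ∷ reverse poss) ++ reverse negs          ≡⟨ cong (λ x → (+ 0 ∷ x) ++ reverse negs) (LP.reverse-involutive _) ⟩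
    (+ 0 ∷ map (λ j → + suc j) (upTo B)) ++ reverse negs
      ≡⟨ cong (λ x → (+ 0 ∷ x) ++ reverse negs)
              (trans (LP.map-upTo (λ j → + suc j) B) (sym (LP.map-applyUpTo suc +_ B))) ⟩
    map +_ (upTo (suc B)) ++ reverse negs        ∎
    where
      negs poss : List ℤ
      negs = map (λ j → -[1+ j ]) (upTo B)
      poss = reverse (map (λ j → + suc j) (upTo B))

  switchBlock : Word → ℤ → Word
  switchBlock u t = flip (reverse (lettersAtLevel rise fall u t))

  letters-at-level : ∀ {d w} → Admissible d w → ∀ t →
    lettersAtLevel rise fall (rev (flip w)) t ≡ map proj₁ (filter (λ p → proj₂ p ℤ.≟ t) (map flipLabel (labelled d w)))
  letters-at-level adm t = cong (λ qs → map proj₁ (filter (λ p → proj₂ p ℤ.≟ t) qs)) (proj₁ (rev-flip-levels adm))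

  switchBlock-nonnegative : ∀ {d w} → Admissible d w → ∀ i →
    switchBlock (rev (flip w)) (+ i) ≡ reverse (stepsAt i (labelled d w))
  switchBlock-nonnegative {d} {w} adm i = begin
    flip (reverse (letters (+ i))) ≡⟨ LP.reverse-map flipStep (letters (+ i)) ⟩
    reverse (flip (letters (+ i))) ≡⟨ cong (λ x → reverse (flip x)) (letters-at-level adm (+ i)) ⟩
    reverse (flip (map proj₁ (filter (λ p → proj₂ p ℤ.≟ + i) (map flipLabel (labelled d w)))))
                                   ≡⟨ cong reverse (select-level (labelled d w) i) ⟩
    reverse (stepsAt i (labelled d w)) ∎
    where letters = lettersAtLevel rise fall (rev (flip w))

  switchBlock-negative : ∀ {d w} → Admissible d w → ∀ j → switchBlock (rev (flip w)) -[1+ j ] ≡ []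
  switchBlock-negative {d} {w} adm j =
    cong (λ x → flip (reverse x)) (trans (letters-at-level adm -[1+ j ]) (select-negative (labelled d w) j))

  switch-side : ∀ {d w} → Admissible d w →
    flip (rev (sw⁻ rise fall (rev (flip w))))
      ≡ concat (map (λ i → reverse (stepsAt i (labelled d w))) (upTo (suc (levelBound rise fall (rev (flip w))))))
  switch-side {d} {w} adm = begin
    flip (reverse (concat (map (lettersAtLevel rise fall u) (levelOrder B))))
      ≡⟨ flip-reverse-concat (lettersAtLevel rise fall u) (levelOrder B) ⟩
    concat (map block (reverse (levelOrder B)))
      ≡⟨ cong (λ ls → concat (map block ls)) (levelOrder-reverse B) ⟩
    concat (map block (map +_ (upTo (suc B)) ++ reverse negs))
      ≡⟨ cong concat (LP.map-++ block (map +_ (upTo (suc B))) (reverse negs)) ⟩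
    concat (map block (map +_ (upTo (suc B))) ++ map block (reverse negs))
      ≡⟨ sym (LP.concat-++ (map block (map +_ (upTo (suc B)))) (map block (reverse negs))) ⟩
    concat (map block (map +_ (upTo (suc B)))) ++ concat (map block (reverse negs))
      ≡⟨ cong₂ _++_ (cong concat (trans (sym (LP.map-∘ (upTo (suc B))))
                                        (LP.map-cong (switchBlock-nonnegative adm) (upTo (suc B)))))
                    negatives-empty ⟩
    concat (map (λ i → reverse (stepsAt i (labelled d w))) (upTo (suc B))) ++ []
      ≡⟨ LP.++-identityʳ _ ⟩
    concat (map (λ i → reverse (stepsAt i (labelled d w))) (upTo (suc B))) ∎
    where
      u : Word
      u = rev (flip w)
      B : ℕ
      B = levelBound rise fall u
      negs : List ℤ
      negs = map -[1+_] (upTo B)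
      block : ℤ → Word
      block = switchBlock u
      negatives-empty : concat (map block (reverse negs)) ≡ []
      negatives-empty = begin
        concat (map block (reverse negs))
          ≡⟨ cong (λ js → concat (map block js)) (sym (LP.reverse-map -[1+_] (upTo B))) ⟩
        concat (map block (map -[1+_] (reverse (upTo B))))
          ≡⟨ cong concat (sym (LP.map-∘ (reverse (upTo B)))) ⟩
        concat (map (λ j → block -[1+ j ]) (reverse (upTo B)))
          ≡⟨ concat-map-empty (λ j → block -[1+ j ]) (reverse (upTo B)) (switchBlock-negative adm) ⟩
        [] ∎

  module Line (k : ℕ) where

    line-step : ∀ {x d y} → x + d ≡ k + m * y → x + (d + m) ≡ k + m * suc y
    line-step {x} {d} {y} on = begin
      x + (d + m)       ≡⟨ sym (ℕP.+-assoc x d m) ⟩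
      x + d + m         ≡⟨ cong (_+ m) on ⟩
      k + m * y + m     ≡⟨ ℕP.+-assoc k (m * y) m ⟩
      k + (m * y + m)   ≡⟨ cong (_+_ k) (trans (ℕP.+-comm (m * y) m) (sym (ℕP.*-suc m y))) ⟩
      k + m * suc y     ∎

    fromLine : ∀ {x d y} w → x + d ≡ k + m * y →
      (∀ j → x + countE (take j w) ≤ k + m * (y + countN (take j w))) →
      x + countE w ≡ k + m * (y + countN w) →
      Admissible d w × areaAux k m x y w ≡ areaFrom d w
    fromLine {x} {zero} [] _ _ _ = end , refl
    fromLine {x} {suc d} {y} [] on _ ends = ⊥-elim (ℕP.m+1+n≢m x (begin
      x + suc d          ≡⟨ on ⟩
      k + m * y          ≡⟨ cong (λ t → k + m * t) (sym (ℕP.+-identityʳ y)) ⟩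
      k + m * (y + 0)    ≡⟨ sym ends ⟩
      x + 0              ≡⟨ ℕP.+-identityʳ x ⟩
      x                  ∎))
    fromLine {x} {d} {y} (N ∷ w) on weakly ends =
      up (proj₁ rest) , cong₂ _∷_ emitted (proj₂ rest)
      where
        shift : ∀ c → k + m * (y + suc c) ≡ k + m * (suc y + c)
        shift c = cong (λ t → k + m * t) (ℕP.+-suc y c)
        emitted : k + m * y ∸ x ≡ d
        emitted = trans (cong (_∸ x) (sym on)) (ℕP.m+n∸m≡n x d)
        rest : Admissible (d + m) w × areaAux k m x (suc y) w ≡ areaFrom (d + m) w
        rest = fromLine {x} {d + m} {suc y} w (line-step {x} {d} {y} on)
                 (λ j → subst (x + countE (take j w) ≤_) (shift (countN (take j w))) (weakly (suc j)))
                 (trans ends (shift (countN w)))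
    fromLine {x} {zero} {y} (E ∷ w) on weakly _ =
      ⊥-elim (ℕP.<-irrefl refl (ℕP.+-cancelˡ-≤ x 1 0 (subst (x + 1 ≤_) back-on-line (weakly 1))))
      where
        back-on-line : k + m * (y + 0) ≡ x + 0
        back-on-line = trans (cong (λ t → k + m * t) (ℕP.+-identityʳ y)) (sym on)
    fromLine {x} {suc d} {y} (E ∷ w) on weakly ends =
      left (proj₁ rest) , proj₂ rest
      where
        rest : Admissible d w × areaAux k m (suc x) y w ≡ areaFrom d w
        rest = fromLine {suc x} {d} {y} w (trans (sym (ℕP.+-suc x d)) on)
                 (λ j → subst (_≤ k + m * (y + countN (take j w))) (ℕP.+-suc x (countE (take j w))) (weakly (suc j)))
                 (trans (sym (ℕP.+-suc x (countE w))) ends)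

    admissible : ∀ {n w} → InT n k m w → Admissible k w × areaVector k m w ≡ areaFrom k w
    admissible {w = w} inT = fromLine w start weakly ends′
      where
        open InT inT
        start : 0 + k ≡ k + m * 0
        start = sym (trans (cong (_+_ k) (ℕP.*-zeroʳ m)) (ℕP.+-identityʳ k))
        ends′ : 0 + countE w ≡ k + m * (0 + countN w)
        ends′ = trans endE (cong (λ t → k + m * t) (sym endN))

    distance-bound : ∀ {n w} → InT n k m w → k + m * countN w ≤ levelBound rise fall (rev (flip w))
    distance-bound {w = w} inT =
      ℕP.≤-trans (ℕP.≤-reflexive on-line)
        (ℕP.≤-trans (countE≤length w)
          (ℕP.≤-trans (ℕP.≤-reflexive same-length) (ℕP.m≤m*n (length (rev (flip w))) (suc ∣ fall ∣))))
      where
        open InT inT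
        on-line : k + m * countN w ≡ countE w
        on-line = trans (cong (λ t → k + m * t) endN) (sym endE)
        same-length : length w ≡ length (rev (flip w))
        same-length = sym (trans (LP.length-reverse (flip w)) (LP.length-map flipStep w))

theorem4p2 : (n k m : ℕ) → 0 < n → 0 < m → (P : Word) → InT n k m P →
    φ′ n k m P ≡ flip (rev (sw⁻ (+ 1) (- (+ m)) (rev (flip P))))
theorem4p2 n k m _ _ P inT = begin
  φ′ n k m P
    ≡⟨ cong (λ g → concat (map (block g) (upTo (suc (k + bigM m g))))) area ⟩
  concat (map (block g) (upTo (suc (k + bigM m g))))
    ≡⟨ concat-upTo-agree (τ-block adm) (block-vanish k g) steps-vanish ⟩
  concat (map (λ i → reverse (stepsAt i (labelled k P))) (upTo (suc B)))
    ≡⟨ sym (switch-side adm) ⟩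
  flip (rev (sw⁻ (+ 1) (- (+ m)) (rev (flip P)))) ∎
  where
    open Distance m
    open Line k
    block : List ℕ → ℕ → Word
    block g i = extraE k i ++ τ k m g i
    adm : Admissible k P
    adm = proj₁ (admissible inT)
    area : areaVector k m P ≡ areaFrom k P
    area = proj₂ (admissible inT)
    g : List ℕ
    g = areaFrom k P
    B : ℕ
    B = levelBound rise fall (rev (flip P))
    steps-vanish : ∀ i → suc B ≤ i → reverse (stepsAt i (labelled k P)) ≡ []
    steps-vanish i B<i = cong reverse (stepsAt-vanish adm i (ℕP.<-≤-trans (s≤s (distance-bound inT)) B<i))
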